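{- The triple $(\mathscr{A},\preccurlyeq,\to)$ is an implicative structure: $(\mathscr{A},\preccurlyeq)$ is a complete lattice; if $a'\preccurlyeq a$ and $b\preccurlyeq b'$ then $(a\to b)\preccurlyeq(a'\to b')$; and for all $a\in\mathscr{A}$ and $B\subseteq\mathscr{A}$, $a\to\bigwedge_{b\in B}b=\bigwedge_{b\in B}(a\to b)$, where $\bigwedge$ denotes the meet in $(\mathscr{A},\preccurlyeq)$.
   Context: Let $\Sigma$ be a set equipped with operations $\dot\to:\Sigma\times\Sigma\to\Sigma$ and $\dot\bigwedge:\mathfrak{P}(\Sigma)\to\Sigma$ (in the paper these are codes, w.r.t. a generic predicate $\mathrm{tr}_\Sigma\in\mathsf{P}\Sigma$ of a fixed $\mathbf{Set}$-based tripos $\mathsf{P}$, for implication and universal quantification). The set $\mathscr{A}_0$ of atoms is defined inductively: $\dot\xi\in\mathscr{A}_0$ for each $\xi\in\Sigma$, and $(s\mapsto\alpha)\in\mathscr{A}_0$ for $s\in\mathfrak{P}(\Sigma)$ and $\alpha\in\mathscr{A}_0$. It is preordered by the rules $\dot\xi\le\dot\xi$, and $s\mapsto\alpha\le s'\mapsto\alpha'$ whenever $s\subseteq s'$ and $\alpha\le\alpha'$. Define $\phi_0:\mathscr{A}_0\to\Sigma$ by $\phi_0(\dot\xi)=\xi$ and $\phi_0(s\mapsto\alpha)=(\dot\bigwedge s)\mathbin{\dot\to}\phi_0(\alpha)$. Let $\mathscr{A}$ be the set of upwards closed subsets of $\mathscr{A}_0$, ordered by $a\preccurlyeq b$ iff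 $a\supseteq b$ (so meets are unions: $\bigwedge B=\bigcup B$). For $a\in\mathscr{A}$ let $\tilde\phi_0(a)=\{\phi_0(\alpha):\alpha\in a\}$, and define $a\to b:=\{s\mapsto\beta : s\in\mathfrak{P}(\Sigma),\ \tilde\phi_0(a)\subseteq s,\ \beta\in b\}$. -}

module Defs where

open import Level using (Level; 0ℓ; Lift) renaming (suc to lsuc)
open import Data.Product using (Σ; ∃; _×_; _,_; proj₁; proj₂)
open import Relation.Unary using (Pred; _⊆_; _∈_)
open import Relation.Binary.PropositionalEquality using (_≡_; refl)
open import Relation.Binary.Structures using (IsPartialOrder)

-- The data of the paper: a set Σ of codes with a code for implication
-- and a code for universal quantification over an arbitrary subset of Σ.
record Codes : Set₁ where
  field
    Σc  : Set
    _⇒̇_ : Σc → Σc → Σc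
    ⋀̇   : Pred Σc 0ℓ → Σc

module _ (C : Codes) where
  open Codes C

  data A₀ : Set₁ where
    dot : Σc → A₀
    _↦_ : Pred Σc 0ℓ → A₀ → A₀

  data _≤₀_ : A₀ → A₀ → Set₁ where
    dot≤ : ∀ ξ → dot ξ ≤₀ dot ξ
    ↦≤   : ∀ {s s' α α'} → s ⊆ s' → α ≤₀ α' → (s ↦ α) ≤₀ (s' ↦ α')

  φ₀ : A₀ → Σc
  φ₀ (dot ξ) = ξ
  φ₀ (s ↦ α) = ⋀̇ s ⇒̇ φ₀ α

  UpwardClosed : Pred A₀ (lsuc 0ℓ) → Set₁
  UpwardClosed P = ∀ {α β} → α ≤₀ β → P α → P β

  record 𝒜 : Set₂ where
    constructor up
    field
      set    : Pred A₀ (lsuc 0ℓ)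
      closed : UpwardClosed set
  open 𝒜 public

  _≼_ : 𝒜 → 𝒜 → Set₁
  a ≼ b = set b ⊆ set a

  _≈_ : 𝒜 → 𝒜 → Set₁
  a ≈ b = (a ≼ b) × (b ≼ a)

  ⋀ : {I : Set₁} → (I → 𝒜) → 𝒜
  ⋀ {I} B = up (λ α → Σ I λ i → α ∈ set (B i))
               (λ le m → proj₁ m , closed (B (proj₁ m)) le (proj₂ m))

  φ̃₀⊆ : 𝒜 → Pred Σc 0ℓ → Set₁
  φ̃₀⊆ a s = ∀ α → α ∈ set a → φ₀ α ∈ s

  arrowSet : 𝒜 → 𝒜 → Pred A₀ (lsuc 0ℓ)
  arrowSet a b γ = Σ (Pred Σc 0ℓ) λ s → Σ A₀ λ β →
                     (γ ≡ (s ↦ β)) × φ̃₀⊆ a s × β ∈ set b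

  arrowClosed : ∀ a b → UpwardClosed (arrowSet a b)
  arrowClosed a b (↦≤ {s' = s'} {α' = β'} ss bb) (_ , _ , refl , h , m) =
    s' , β' , refl , (λ α x → ss (h α x)) , closed b bb m

  _⟶_ : 𝒜 → 𝒜 → 𝒜
  a ⟶ b = up (arrowSet a b) (arrowClosed a b)

  IsInfimum : {I : Set₁} → (I → 𝒜) → 𝒜 → Set₂
  IsInfimum {I} B m = (∀ i → m ≼ B i) × (∀ x → (∀ i → x ≼ B i) → x ≼ m)

  IsSupremum : {I : Set₁} → (I → 𝒜) → 𝒜 → Set₂
  IsSupremum {I} B j = (∀ i → B i ≼ j) × (∀ x → (∀ i → B i ≼ x) → j ≼ x)

  IsCompleteLattice : Set₂
  IsCompleteLattice =
    IsPartialOrder _≈_ _≼_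
    × (∀ {I : Set₁} (B : I → 𝒜) → ∃ λ m → IsInfimum B m)
    × (∀ {I : Set₁} (B : I → 𝒜) → ∃ λ j → IsSupremum B j)

  IsImplicativeStructure : Set₂
  IsImplicativeStructure =
    IsCompleteLattice
    × (∀ {I : Set₁} (B : I → 𝒜) → IsInfimum B (⋀ B))
    × (∀ {a a' b b'} → a' ≼ a → b ≼ b' → (a ⟶ b) ≼ (a' ⟶ b'))
    × (∀ (a : 𝒜) {I : Set₁} (B : I → 𝒜) → (a ⟶ ⋀ B) ≈ ⋀ (λ i → a ⟶ B i))

module Submission where

open import Defs
open import Data.Product using (∃; _,_; proj₁)
open import Relation.Binary.Structures using (IsEquivalence; IsPreorder; IsPartialOrder)

-- Since ≼ is reverse inclusion of upward closed sets, meets are unions and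
-- joins are intersections. The arrow a ⟶ b is antitone in a because the side
-- condition φ̃₀(a) ⊆ s only weakens as a shrinks, and it commutes with unions
-- in b because that side condition does not mention b at all.
module _ (C : Codes) where
  open Codes C

  ≈-isEquivalence : IsEquivalence (_≈_ C)
  ≈-isEquivalence = record
    { refl  = (λ x → x) , (λ x → x)
    ; sym   = λ (a≼b , b≼a) → b≼a , a≼b
    ; trans = λ (a≼b , b≼a) (b≼c , c≼b) → (λ x → a≼b (b≼c x)) , (λ x → c≼b (b≼a x))
    }

  ≼-isPreorder : IsPreorder (_≈_ C) (_≼_ C)
  ≼-isPreorder = record
    { isEquivalence = ≈-isEquivalence
    ; reflexive     = proj₁
    ; trans         = λ a≼b b≼c x → a≼b (b≼c x)
    }

  ≼-isPartialOrder : IsPartialOrder (_≈_ C) (_≼_ C)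
  ≼-isPartialOrder = record
    { isPreorder = ≼-isPreorder
    ; antisym    = _,_
    }

  ⋀-isInfimum : ∀ {I : Set₁} (B : I → 𝒜 C) → IsInfimum C B (⋀ C B)
  ⋀-isInfimum B = (λ i α∈Bi → i , α∈Bi) , (λ x x≼B (i , α∈Bi) → x≼B i α∈Bi)

  ⋁ : ∀ {I : Set₁} → (I → 𝒜 C) → 𝒜 C
  ⋁ B = up (λ α → ∀ i → set (B i) α) (λ α≤β α∈B i → closed (B i) α≤β (α∈B i))

  ⋁-isSupremum : ∀ {I : Set₁} (B : I → 𝒜 C) → IsSupremum C B (⋁ B)
  ⋁-isSupremum B = (λ i α∈⋁B → α∈⋁B i) , (λ x B≼x α∈x i → B≼x i α∈x)

  isCompleteLattice : IsCompleteLattice C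
  isCompleteLattice =
    ≼-isPartialOrder , (λ B → ⋀ C B , ⋀-isInfimum B) , (λ B → ⋁ B , ⋁-isSupremum B)

  ⟶-mono-≼ : ∀ {a a' b b'} → _≼_ C a' a → _≼_ C b b' → _≼_ C (_⟶_ C a b) (_⟶_ C a' b')
  ⟶-mono-≼ a'≼a b≼b' (s , β , γ≡s↦β , φ̃₀a⊆s , β∈b) =
    s , β , γ≡s↦β , (λ α α∈a' → φ̃₀a⊆s α (a'≼a α∈a')) , b≼b' β∈b

  ⟶-distribˡ-⋀ : ∀ (a : 𝒜 C) {I : Set₁} (B : I → 𝒜 C) →
                 _≈_ C (_⟶_ C a (⋀ C B)) (⋀ C (λ i → _⟶_ C a (B i)))
  ⟶-distribˡ-⋀ a B =
      (λ (i , (s , β , γ≡s↦β , φ̃₀a⊆s , β∈Bi)) → s , β , γ≡s↦β , φ̃₀a⊆s , (i , β∈Bi))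
    , (λ (s , β , γ≡s↦β , φ̃₀a⊆s , (i , β∈Bi)) → i , (s , β , γ≡s↦β , φ̃₀a⊆s , β∈Bi))

proposition3p4 : (C : Codes) → IsImplicativeStructure C
proposition3p4 C =
    isCompleteLattice C
  , ⋀-isInfimum C
  , (λ {a} {a'} {b} {b'} → ⟶-mono-≼ C {a} {a'} {b} {b'})
  , ⟶-distribˡ-⋀ C
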